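{- Let $G$ be the graph with vertex set $\{x_1,\dots,x_7\}$ obtained as the union of the complete graph on $\{x_1,x_2,x_3,x_4\}$ and the complete graph on $\{x_1,x_5,x_6,x_7\}$, together with one additional edge $x_2x_5$. Then removing the vertex $x_1$ and the edge $x_2x_5$ disconnects $G$, and for every pair of distinct vertices $v_1,v_2\in V(G)$ there exist three pairwise edge-disjoint $v_1$-$v_2$ paths of which two are internally disjoint.
   Context: Internally disjoint $v_1$-$v_2$ paths share only the vertices $v_1$ and $v_2$; edge-disjoint paths share no edge. -}

module Defs where

open import Data.Nat using (ℕ; _≤ᵇ_; _≡ᵇ_)
open import Data.Fin using (Fin; toℕ; zero; suc)
open import Data.Bool using (Bool; true; false; _∧_; _∨_; not; T)
open import Data.List using (List; []; _∷_; _++_; [_])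
open import Data.List.Membership.Propositional using (_∈_; _∉_)
open import Data.List.Relation.Unary.Linked using (Linked)
open import Data.List.Relation.Unary.Unique.Propositional using (Unique)
open import Data.Product using (Σ; _×_; _,_)
open import Data.Sum using (_⊎_)
open import Relation.Binary.PropositionalEquality using (_≡_; _≢_)
open import Relation.Nullary using (¬_)
open import Relation.Binary.Construct.Closure.ReflexiveTransitive using (Star)

module GraphNotions {V : Set} (E : V → V → Set) where

  SameEdge : V × V → V × V → Set
  SameEdge (a , b) (c , d) = (a ≡ c × b ≡ d) ⊎ (a ≡ d × b ≡ c)

  edges : List V → List (V × V)
  edges []           = []
  edges (x ∷ [])     = []
  edges (x ∷ y ∷ xs) = (x , y) ∷ edges (y ∷ xs)

  pathVerts : V → List V → V → List V
  pathVerts u mid v = u ∷ (mid ++ [ v ])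

  IsPath : V → V → List V → Set
  IsPath u v mid = Linked E (pathVerts u mid v) × Unique (pathVerts u mid v)

  Path : V → V → Set
  Path u v = Σ (List V) (IsPath u v)

  internal : ∀ {u v} → Path u v → List V
  internal (mid , _) = mid

  verts : ∀ {u v} → Path u v → List V
  verts {u} {v} (mid , _) = pathVerts u mid v

  EdgeDisjoint : ∀ {u v} → Path u v → Path u v → Set
  EdgeDisjoint p q = ∀ e f → e ∈ edges (verts p) → f ∈ edges (verts q) → ¬ SameEdge e f

  InternallyDisjoint : ∀ {u v} → Path u v → Path u v → Set
  InternallyDisjoint p q = ∀ x → x ∈ internal p → x ∉ internal q

-- The graph G on {x1,...,x7}; x_i is represented by the element i-1 of Fin 7.

x₁ x₂ x₅ : Fin 7
x₁ = zero
x₂ = suc zero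
x₅ = suc (suc (suc (suc zero)))

inA : Fin 7 → Bool
inA i = toℕ i ≤ᵇ 3

inB : Fin 7 → Bool
inB i = (toℕ i ≡ᵇ 0) ∨ (4 ≤ᵇ toℕ i)

isX2X5 : Fin 7 → Fin 7 → Bool
isX2X5 i j = ((toℕ i ≡ᵇ 1) ∧ (toℕ j ≡ᵇ 4)) ∨ ((toℕ i ≡ᵇ 4) ∧ (toℕ j ≡ᵇ 1))

adjG : Fin 7 → Fin 7 → Bool
adjG i j = not (toℕ i ≡ᵇ toℕ j) ∧ ((inA i ∧ inA j) ∨ (inB i ∧ inB j) ∨ isX2X5 i j)

G : Fin 7 → Fin 7 → Set
G i j = T (adjG i j)

G' : Fin 7 → Fin 7 → Set
G' i j = G i j × i ≢ x₁ × j ≢ x₁ × ¬ GraphNotions.SameEdge G (i , j) (x₂ , x₅)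

Disconnected' : Set
Disconnected' = Σ (Fin 7) λ u → Σ (Fin 7) λ w → u ≢ x₁ × w ≢ x₁ × ¬ Star G' u w

module Submission where

-- Colour each vertex by whether it lies in the clique
-- {x1,x2,x3,x4}.  The only edges of G joining the two colour classes are
-- incident to x1 or equal x2x5; hence every edge of G − x1 − x2x5 preserves
-- the colour, and so does every walk (`walk-preserves`).  The vertices x3
-- and x6 have different colours, so no walk joins them.

open import Defs
open import Data.Bool using (true; false)
open import Data.Bool.Properties using (T?) renaming (_≟_ to _≟ᵇ_)
open import Data.Fin using (Fin; zero; suc)
open import Data.Fin.Properties using (all?) renaming (_≟_ to _≟ᶠ_)
open import Data.Empty using (⊥-elim)
open import Data.List using (List; []; _∷_)
open import Data.List.Membership.Propositional using (_∈_)
open import Data.List.Relation.Unary.All as All using ()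
open import Data.List.Relation.Unary.AllPairs using (allPairs?)
open import Data.List.Relation.Unary.Linked using (linked?)
open import Data.Product using (Σ; _×_; _,_)
open import Relation.Binary.Construct.Closure.ReflexiveTransitive as Star using (Star)
open import Relation.Binary.Definitions using (Decidable; DecidableEquality)
open import Relation.Binary.PropositionalEquality using (_≡_; _≢_; refl; trans)
open import Relation.Nullary using (Dec; ¬?)
open import Relation.Nullary.Decidable using (True; toWitness; map′; _×-dec_; _⊎-dec_; _→-dec_)

walk-preserves : ∀ {V B : Set} {R : V → V → Set} (f : V → B) →
                 (∀ {i j} → R i j → f i ≡ f j) →
                 ∀ {u w} → Star R u w → f u ≡ f w
walk-preserves f step = Star.fold (λ u w → f u ≡ f w) (λ r eq → trans (step r) eq) refl

module Decidability {V : Set} (_≟_ : DecidableEquality V)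
                    {E : V → V → Set} (E? : Decidable E) where

  open GraphNotions E
  open import Data.List.Membership.DecPropositional _≟_ using (_∈?_)

  ∀∈? : ∀ {A : Set} {P : A → Set} → (∀ x → Dec (P x)) →
        (xs : List A) → Dec (∀ x → x ∈ xs → P x)
  ∀∈? P? xs = map′ (λ all x x∈ → All.lookup all x∈)
                   (λ h → All.tabulate (λ {x} → h x))
                   (All.all? P? xs)

  isPath? : ∀ u v mid → Dec (IsPath u v mid)
  isPath? u v mid = linked? E? (pathVerts u mid v)
                    ×-dec allPairs? (λ x y → ¬? (x ≟ y)) (pathVerts u mid v)

  sameEdge? : ∀ e f → Dec (SameEdge e f)
  sameEdge? (a , b) (c , d) = ((a ≟ c) ×-dec (b ≟ d)) ⊎-dec ((a ≟ d) ×-dec (b ≟ c))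

  edgeDisjoint? : ∀ {u v} (P Q : Path u v) → Dec (EdgeDisjoint P Q)
  edgeDisjoint? P Q =
    map′ (λ h e f e∈ f∈ → h e e∈ f f∈) (λ h e e∈ f f∈ → h e f e∈ f∈)
         (∀∈? (λ e → ∀∈? (λ f → ¬? (sameEdge? e f)) (edges (verts Q))) (edges (verts P)))

  internallyDisjoint? : ∀ {u v} (P Q : Path u v) → Dec (InternallyDisjoint P Q)
  internallyDisjoint? P Q = ∀∈? (λ x → ¬? (x ∈? internal Q)) (internal P)

  ThreePaths : V → V → Set
  ThreePaths u v = Σ (Path u v) λ P₁ → Σ (Path u v) λ P₂ → Σ (Path u v) λ P₃ →
    EdgeDisjoint P₁ P₂ × EdgeDisjoint P₁ P₃ × EdgeDisjoint P₂ P₃ × InternallyDisjoint P₁ P₂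

  threePaths : ∀ u v (m₁ m₂ m₃ : List V)
    {p₁ : True (isPath? u v m₁)} {p₂ : True (isPath? u v m₂)} {p₃ : True (isPath? u v m₃)} →
    let P₁ = (m₁ , toWitness p₁) ; P₂ = (m₂ , toWitness p₂) ; P₃ = (m₃ , toWitness p₃) in
    {d₁₂ : True (edgeDisjoint? P₁ P₂)} {d₁₃ : True (edgeDisjoint? P₁ P₃)}
    {d₂₃ : True (edgeDisjoint? P₂ P₃)} {i₁₂ : True (internallyDisjoint? P₁ P₂)} →
    ThreePaths u v
  threePaths u v m₁ m₂ m₃ {p₁} {p₂} {p₃} {d₁₂} {d₁₃} {d₂₃} {i₁₂} =
    (m₁ , toWitness p₁) , (m₂ , toWitness p₂) , (m₃ , toWitness p₃) ,
    toWitness d₁₂ , toWitness d₁₃ , toWitness d₂₃ , toWitness i₁₂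

open Decidability _≟ᶠ_ (λ i j → T? (adjG i j))

pattern x1 = zero
pattern x2 = suc zero
pattern x3 = suc (suc zero)
pattern x4 = suc (suc (suc zero))
pattern x5 = suc (suc (suc (suc zero)))
pattern x6 = suc (suc (suc (suc (suc zero))))
pattern x7 = suc (suc (suc (suc (suc (suc zero)))))

G′? : Decidable G'
G′? i j = T? (adjG i j) ×-dec ¬? (i ≟ᶠ x₁) ×-dec ¬? (j ≟ᶠ x₁)
          ×-dec ¬? (sameEdge? (i , j) (x₂ , x₅))

edge-stays-in-side : ∀ {i j} → G' i j → inA i ≡ inA j
edge-stays-in-side {i} {j} =
  toWitness {a? = all? λ i → all? λ j → G′? i j →-dec (inA i ≟ᵇ inA j)} _ i j

disconnected : Disconnected'
disconnected = x3 , x6 , (λ ()) , (λ ()) ,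
  λ walk → true≢false (walk-preserves inA edge-stays-in-side walk)
  where
  true≢false : true ≢ false
  true≢false ()

-- Within a clique, P₁ is the edge v₁v₂ and P₂, P₃ are
-- paths of length two.  Between the cliques, one of P₁ P₂ passes through x1
-- and the other uses the edge x2x5; P₃ passes through x1 as well, but enters
-- and leaves it along edges not used by P₁ and P₂.
threePathsG : (v₁ v₂ : Fin 7) → v₁ ≢ v₂ → ThreePaths v₁ v₂
threePathsG x1 x2 _ = threePaths x1 x2 [] (x3 ∷ []) (x4 ∷ [])
threePathsG x1 x3 _ = threePaths x1 x3 [] (x2 ∷ []) (x4 ∷ [])
threePathsG x1 x4 _ = threePaths x1 x4 [] (x2 ∷ []) (x3 ∷ [])
threePathsG x1 x5 _ = threePaths x1 x5 [] (x2 ∷ []) (x6 ∷ [])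
threePathsG x1 x6 _ = threePaths x1 x6 [] (x5 ∷ []) (x7 ∷ [])
threePathsG x1 x7 _ = threePaths x1 x7 [] (x5 ∷ []) (x6 ∷ [])
threePathsG x2 x1 _ = threePaths x2 x1 [] (x3 ∷ []) (x4 ∷ [])
threePathsG x2 x3 _ = threePaths x2 x3 [] (x1 ∷ []) (x4 ∷ [])
threePathsG x2 x4 _ = threePaths x2 x4 [] (x1 ∷ []) (x3 ∷ [])
threePathsG x2 x5 _ = threePaths x2 x5 [] (x1 ∷ []) (x3 ∷ x1 ∷ x6 ∷ [])
threePathsG x2 x6 _ = threePaths x2 x6 (x1 ∷ []) (x5 ∷ []) (x3 ∷ x1 ∷ x7 ∷ [])
threePathsG x2 x7 _ = threePaths x2 x7 (x1 ∷ []) (x5 ∷ []) (x3 ∷ x1 ∷ x6 ∷ [])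
threePathsG x3 x1 _ = threePaths x3 x1 [] (x2 ∷ []) (x4 ∷ [])
threePathsG x3 x2 _ = threePaths x3 x2 [] (x1 ∷ []) (x4 ∷ [])
threePathsG x3 x4 _ = threePaths x3 x4 [] (x1 ∷ []) (x2 ∷ [])
threePathsG x3 x5 _ = threePaths x3 x5 (x1 ∷ []) (x2 ∷ []) (x4 ∷ x1 ∷ x6 ∷ [])
threePathsG x3 x6 _ = threePaths x3 x6 (x1 ∷ []) (x2 ∷ x5 ∷ []) (x4 ∷ x1 ∷ x7 ∷ [])
threePathsG x3 x7 _ = threePaths x3 x7 (x1 ∷ []) (x2 ∷ x5 ∷ []) (x4 ∷ x1 ∷ x6 ∷ [])
threePathsG x4 x1 _ = threePaths x4 x1 [] (x2 ∷ []) (x3 ∷ [])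
threePathsG x4 x2 _ = threePaths x4 x2 [] (x1 ∷ []) (x3 ∷ [])
threePathsG x4 x3 _ = threePaths x4 x3 [] (x1 ∷ []) (x2 ∷ [])
threePathsG x4 x5 _ = threePaths x4 x5 (x1 ∷ []) (x2 ∷ []) (x3 ∷ x1 ∷ x6 ∷ [])
threePathsG x4 x6 _ = threePaths x4 x6 (x1 ∷ []) (x2 ∷ x5 ∷ []) (x3 ∷ x1 ∷ x7 ∷ [])
threePathsG x4 x7 _ = threePaths x4 x7 (x1 ∷ []) (x2 ∷ x5 ∷ []) (x3 ∷ x1 ∷ x6 ∷ [])
threePathsG x5 x1 _ = threePaths x5 x1 [] (x2 ∷ []) (x6 ∷ [])
threePathsG x5 x2 _ = threePaths x5 x2 [] (x1 ∷ []) (x6 ∷ x1 ∷ x3 ∷ [])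
threePathsG x5 x3 _ = threePaths x5 x3 (x1 ∷ []) (x2 ∷ []) (x6 ∷ x1 ∷ x4 ∷ [])
threePathsG x5 x4 _ = threePaths x5 x4 (x1 ∷ []) (x2 ∷ []) (x6 ∷ x1 ∷ x3 ∷ [])
threePathsG x5 x6 _ = threePaths x5 x6 [] (x1 ∷ []) (x7 ∷ [])
threePathsG x5 x7 _ = threePaths x5 x7 [] (x1 ∷ []) (x6 ∷ [])
threePathsG x6 x1 _ = threePaths x6 x1 [] (x5 ∷ []) (x7 ∷ [])
threePathsG x6 x2 _ = threePaths x6 x2 (x1 ∷ []) (x5 ∷ []) (x7 ∷ x1 ∷ x3 ∷ [])
threePathsG x6 x3 _ = threePaths x6 x3 (x1 ∷ []) (x5 ∷ x2 ∷ []) (x7 ∷ x1 ∷ x4 ∷ [])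
threePathsG x6 x4 _ = threePaths x6 x4 (x1 ∷ []) (x5 ∷ x2 ∷ []) (x7 ∷ x1 ∷ x3 ∷ [])
threePathsG x6 x5 _ = threePaths x6 x5 [] (x1 ∷ []) (x7 ∷ [])
threePathsG x6 x7 _ = threePaths x6 x7 [] (x1 ∷ []) (x5 ∷ [])
threePathsG x7 x1 _ = threePaths x7 x1 [] (x5 ∷ []) (x6 ∷ [])
threePathsG x7 x2 _ = threePaths x7 x2 (x1 ∷ []) (x5 ∷ []) (x6 ∷ x1 ∷ x3 ∷ [])
threePathsG x7 x3 _ = threePaths x7 x3 (x1 ∷ []) (x5 ∷ x2 ∷ []) (x6 ∷ x1 ∷ x4 ∷ [])
threePathsG x7 x4 _ = threePaths x7 x4 (x1 ∷ []) (x5 ∷ x2 ∷ []) (x6 ∷ x1 ∷ x3 ∷ [])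
threePathsG x7 x5 _ = threePaths x7 x5 [] (x1 ∷ []) (x6 ∷ [])
threePathsG x7 x6 _ = threePaths x7 x6 [] (x1 ∷ []) (x5 ∷ [])
threePathsG x1 x1 v₁≢v₂ = ⊥-elim (v₁≢v₂ refl)
threePathsG x2 x2 v₁≢v₂ = ⊥-elim (v₁≢v₂ refl)
threePathsG x3 x3 v₁≢v₂ = ⊥-elim (v₁≢v₂ refl)
threePathsG x4 x4 v₁≢v₂ = ⊥-elim (v₁≢v₂ refl)
threePathsG x5 x5 v₁≢v₂ = ⊥-elim (v₁≢v₂ refl)
threePathsG x6 x6 v₁≢v₂ = ⊥-elim (v₁≢v₂ refl)
threePathsG x7 x7 v₁≢v₂ = ⊥-elim (v₁≢v₂ refl)

mainTheorem7 : Disconnected' × ((v₁ v₂ : Fin 7) → v₁ ≢ v₂ → Σ (GraphNotions.Path G v₁ v₂) λ P₁ → Σ (GraphNotions.Path G v₁ v₂) λ P₂ → Σ (GraphNotions.Path G v₁ v₂) λ P₃ → GraphNotions.EdgeDisjoint G P₁ P₂ × GraphNotions.EdgeDisjoint G P₁ P₃ × GraphNotions.EdgeDisjoint G P₂ P₃ × GraphNotions.InternallyDisjoint G P₁ P₂)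
mainTheorem7 = disconnected , threePathsG
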